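{- Let $H$ be a simple finite connected graph which is $t$-total-critical, where $t\geq \Delta(H)+2$. Then $H$ has no cut-vertices.
   Context: $\Delta(H)$ is the maximum degree. A total coloring of $H$ assigns colors to $V(H)\cup E(H)$ so that adjacent vertices, adjacent edges, and an edge and either of its endpoints always receive distinct colors; $\chi''(H)$ is the minimum number of colors in a total coloring. $H$ is $t$-total-critical if $\chi''(H)=t$ and $\chi''(H-e)\leq t-1$ for every edge $e$ of $H$. -}

module Defs where

open import Data.Nat using (ℕ; zero; suc; _+_; _∸_; _≤_; _≥_; _<_)
open import Data.Fin using (Fin)
open import Data.Fin.Properties using (_≟_)
open import Data.Bool using (Bool; true; false; _∧_; not)
open import Data.List using (List; []; _∷_; sum; map; filter; length; allFin)
open import Data.Product using (Σ; _×_; _,_; ∃)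
open import Relation.Binary.PropositionalEquality using (_≡_; _≢_)
open import Relation.Nullary using (¬_; does)

record Graph (n : ℕ) : Set where
  field
    adj   : Fin n → Fin n → Bool
    sym   : ∀ u v → adj u v ≡ adj v u
    irrefl : ∀ v → adj v v ≡ false
open Graph public

Adj : ∀ {n} → Graph n → Fin n → Fin n → Set
Adj G u v = adj G u v ≡ true

degree : ∀ {n} → Graph n → Fin n → ℕ
degree {n} G v = length (filter (λ u → adj G v u ≟b true) (allFin n))
  where
    open import Data.Bool.Properties renaming (_≟_ to _≟b_)

maxDegree : ∀ {n} → Graph n → ℕ
maxDegree {n} G = Data.List.foldr Data.Nat._⊔_ 0 (map (degree G) (allFin n))

record TotalColouring {n} (G : Graph n) (k : ℕ) : Set where
  field
    vcol : Fin n → Fin k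
    ecol : Fin n → Fin n → Fin k
    ecol-sym : ∀ u v → Adj G u v → ecol u v ≡ ecol v u
    vv : ∀ u v → Adj G u v → vcol u ≢ vcol v
    ee : ∀ u v w → Adj G u v → Adj G u w → v ≢ w → ecol u v ≢ ecol u w
    ve : ∀ u v → Adj G u v → vcol u ≢ ecol u v

TotalChromatic : ∀ {n} → Graph n → ℕ → Set
TotalChromatic G t = TotalColouring G t × (∀ k → k < t → ¬ TotalColouring G k)

deleteEdge : ∀ {n} → Graph n → Fin n → Fin n → Graph n
deleteEdge {n} G a b = record
  { adj = λ u v → adj G u v ∧ not (isab u v ∨' isab v u)
  ; sym = symP
  ; irrefl = λ v → Eq.cong (λ x → x ∧ not (isab v v ∨ isab v v)) (irrefl G v)
  }
  where
    open import Data.Bool using (_∨_)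
    import Relation.Binary.PropositionalEquality as Eq
    _∨'_ = _∨_
    isab : Fin n → Fin n → Bool
    isab u v = does (u ≟ a) ∧ does (v ≟ b)
    open import Data.Bool.Properties using (∨-comm)
    symP : ∀ u v → (adj G u v ∧ not (isab u v ∨ isab v u)) ≡ (adj G v u ∧ not (isab v u ∨ isab u v))
    symP u v = Eq.cong₂ (λ x y → x ∧ not y) (sym G u v) (∨-comm (isab u v) (isab v u))

-- t-total-critical: χ''(H) = t and χ''(H - e) ≤ t - 1 for every edge e
-- (χ''(H-e) ≤ t-1 iff H-e has a total colouring with t-1 colours)
TotalCritical : ∀ {n} → Graph n → ℕ → Set
TotalCritical G t = TotalChromatic G t ×
  (∀ a b → Adj G a b → TotalColouring (deleteEdge G a b) (t ∸ 1))

data WalkAvoiding {n} (G : Graph n) (P : Fin n → Set) : Fin n → Fin n → Set where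
  here : ∀ {u} → ¬ P u → WalkAvoiding G P u u
  step : ∀ {u v w} → ¬ P u → Adj G u v → WalkAvoiding G P v w → WalkAvoiding G P u w

data Never {n} : Fin n → Set where

Walk : ∀ {n} → Graph n → Fin n → Fin n → Set
Walk G = WalkAvoiding G Never

Connected : ∀ {n} → Graph n → Set
Connected G = ∀ u v → Walk G u v

-- v is a cut-vertex of the connected graph G: removing v disconnects G,
-- i.e. there are two vertices distinct from v not joined by a walk avoiding v.
CutVertex : ∀ {n} → Graph n → Fin n → Set
CutVertex G v = Σ _ λ u → Σ _ λ w → u ≢ v × w ≢ v × ¬ WalkAvoiding G (_≡ v) u w

-- Suppose v separates u from w and let S be the set of vertices reachable from u
-- in H − v. Take a (t−1)-total-colouring c₁ of H − e₁ for an edge e₁ at w and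
-- c₂ of H − e₂ for an edge e₂ at u: c₁ is proper on every element touching S,
-- c₂ on everything else. At v only deg(v) + 1 ≤ t − 1 colours are in play, so
-- the colours of c₂ can be permuted until c₂ gives v the colour c₁ gives it and
-- its edges from v to V ∖ S avoid the c₁-colours of v and of its edges into S.
-- Gluing the two colourings along S yields a (t−1)-total-colouring of H,
-- contradicting χ''(H) = t. Membership in S need not be decidable
-- constructively, but it is so under a double negation, which suffices since
-- the conclusion is a negation.
module Submission where

open import Defs hiding (sym)
open import Data.Nat using (ℕ; zero; suc; _+_; _≤_; _<_; _≥_; _⊔_; pred; s≤s)
open import Data.Nat.Properties
  using (≤-refl; ≤-trans; ≤-reflexive; m≤m⊔n; m≤n⊔m; +-comm; +-suc; +-monoˡ-≤; m+n≤o⇒m≤o; suc-injective)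
open import Data.Fin using (Fin; suc)
open import Data.Fin.Properties using (_≟_; ∀-cons; any?; <⇒notInjective)
open import Data.Fin.Permutation.Components using (transpose; transpose-inverse)
open import Data.Bool using (true)
import Data.Bool.Properties as Bool
open import Data.List using (List; []; _∷_; map; filter; length; allFin; lookup; foldr)
open import Data.List.Properties using (length-map; map-∘; map-id-local; ∷-injective)
open import Data.List.Relation.Unary.All as All using (All; []; _∷_)
import Data.List.Relation.Unary.All.Properties as All
open import Data.List.Relation.Unary.Any as Any using (here; there)
open import Data.List.Relation.Unary.Any.Properties using (lookup-index)
open import Data.List.Relation.Unary.AllPairs using ([]; _∷_)
open import Data.List.Relation.Unary.Unique.Propositional using (Unique)
open import Data.List.Relation.Unary.Unique.Propositional.Properties using (allFin⁺; filter⁺)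
open import Data.List.Membership.Propositional using (_∈_; _∉_)
open import Data.List.Membership.Propositional.Properties using (∈-allFin; ∈-map⁺; ∈-filter⁺; ∈-filter⁻)
open import Data.Product using (_×_; _,_; proj₁; proj₂; ∃; ∃-syntax)
open import Data.Empty using (⊥-elim)
open import Function using (_∘_; id)
open import Function.Definitions using (Injective)
open import Level using (0ℓ)
open import Relation.Binary.PropositionalEquality
open import Relation.Nullary using (¬_; yes; no; ¬?)
open import Relation.Nullary.Decidable using (dec-true; dec-false; decidable-stable; ¬¬-excluded-middle)
open import Relation.Nullary.Negation using (contradiction)
open import Relation.Unary using (Pred; Decidable)
open import Relation.Unary.Properties using (∁?)

¬¬-decidable : ∀ {n ℓ} (P : Pred (Fin n) ℓ) → ¬ ¬ Decidable P
¬¬-decidable {zero}  P k = k (λ ())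
¬¬-decidable {suc n} P k =
  ¬¬-excluded-middle λ P₀? → ¬¬-decidable (P ∘ suc) λ P₊? → k (∀-cons P₀? P₊?)

length-filter+length-filter-∁ : ∀ {a p} {A : Set a} {P : Pred A p} (P? : Decidable P) xs →
  length (filter P? xs) + length (filter (∁? P?) xs) ≡ length xs
length-filter+length-filter-∁ P? []       = refl
length-filter+length-filter-∁ P? (x ∷ xs) with P? x
... | yes _ = cong suc (length-filter+length-filter-∁ P? xs)
... | no  _ = trans (+-suc _ _) (cong suc (length-filter+length-filter-∁ P? xs))

≤-foldr-⊔ : ∀ {a} {A : Set a} (f : A → ℕ) {x xs} → x ∈ xs → f x ≤ foldr _⊔_ 0 (map f xs)
≤-foldr-⊔ f (here refl) = m≤m⊔n _ _
≤-foldr-⊔ f (there x∈xs) = ≤-trans (≤-foldr-⊔ f x∈xs) (m≤n⊔m _ _)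

2+m≤n⇒m<pred[n]<n : ∀ {m n} → suc (suc m) ≤ n → m < pred n × pred n < n
2+m≤n⇒m<pred[n]<n (s≤s m<n) = m<n , ≤-refl

module _ {k : ℕ} where
  open import Data.List.Membership.DecPropositional (_≟_ {k}) using (_∈?_)

  ∃-∉ : (xs : List (Fin k)) → length xs < k → ∃ (_∉ xs)
  ∃-∉ xs |xs|<k with any? (λ c → ¬? (c ∈? xs))
  ... | yes c∉xs = c∉xs
  ... | no ∄c∉xs = ⊥-elim (<⇒notInjective |xs|<k index-injective)
    where
    ∈xs : ∀ c → c ∈ xs
    ∈xs c = decidable-stable (c ∈? xs) (λ c∉xs → ∄c∉xs (c , c∉xs))

    index-injective : Injective _≡_ _≡_ (λ c → Any.index (∈xs c))
    index-injective {c} {d} eq =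
      trans (lookup-index (∈xs c)) (trans (cong (lookup xs) eq) (sym (lookup-index (∈xs d))))

fresh-colours : ∀ {k} (xs : List (Fin k)) d → length xs + d ≤ k →
  ∃[ ys ] length ys ≡ d × Unique ys × All (_∉ xs) ys
fresh-colours xs zero    _    = [] , refl , [] , []
fresh-colours xs (suc d) fits
  with fits′ ← ≤-trans (≤-reflexive (sym (+-suc (length xs) d))) fits
  with c , c∉xs ← ∃-∉ xs (m+n≤o⇒m≤o (suc (length xs)) fits′)
  with ys , |ys|≡d , ys! , ys∉ ← fresh-colours (c ∷ xs) d fits′
  = c ∷ ys , cong suc |ys|≡d , All.map (λ y∉ c≡y → y∉ (here (sym c≡y))) ys∉ ∷ ys!
  , c∉xs ∷ All.map (λ y∉ → y∉ ∘ there) ys∉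

module _ {k} (i j : Fin k) where

  transpose-injective : Injective _≡_ _≡_ (transpose i j)
  transpose-injective eq =
    trans (sym (transpose-inverse j i)) (trans (cong (transpose j i) eq) (transpose-inverse j i))

  transpose-maps-first : transpose i j i ≡ j
  transpose-maps-first rewrite dec-true (i ≟ i) refl = refl

  transpose-fixes : ∀ {x} → x ≢ i → x ≢ j → transpose i j x ≡ x
  transpose-fixes {x} x≢i x≢j rewrite dec-false (x ≟ i) x≢i | dec-false (x ≟ j) x≢j = refl

matching-injection : ∀ {k} {xs ys : List (Fin k)} → Unique xs → Unique ys → length xs ≡ length ys →
  ∃[ π ] Injective _≡_ _≡_ π × map π xs ≡ ys
matching-injection {xs = []}    {[]}    _ _ _ = id , id , refl
matching-injection {k} {x ∷ xs} {y ∷ ys} (x∉xs ∷ xs!) (y∉ys ∷ ys!) |xs|≡|ys|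
  with π , π-inj , πxs≡ys ← matching-injection xs! ys! (suc-injective |xs|≡|ys|)
  = τ ∘ π , π-inj ∘ transpose-injective (π x) y , cong₂ _∷_ (transpose-maps-first (π x) y) τπxs≡ys
  where
  τ : Fin k → Fin k
  τ = transpose (π x) y

  πx∉ys : All (π x ≢_) ys
  πx∉ys = subst (All (π x ≢_)) πxs≡ys (All.map⁺ (All.map (λ x≢a eq → x≢a (π-inj eq)) x∉xs))

  τ-fixes-ys : All (λ z → τ z ≡ z) ys
  τ-fixes-ys = All.zipWith (λ (πx≢z , y≢z) → transpose-fixes (π x) y (≢-sym πx≢z) (≢-sym y≢z)) (πx∉ys , y∉ys)

  τπxs≡ys : map (τ ∘ π) xs ≡ ys
  τπxs≡ys = begin
    map (τ ∘ π) xs   ≡⟨ map-∘ xs ⟩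
    map τ (map π xs) ≡⟨ cong (map τ) πxs≡ys ⟩
    map τ ys         ≡⟨ map-id-local τ-fixes-ys ⟩
    ys               ∎
    where open ≡-Reasoning

separating-injection : ∀ {k} {a b : Fin k} {as bs} → Unique (a ∷ as) → length (b ∷ bs) + length as ≤ k →
  ∃[ π ] Injective _≡_ _≡_ π × π a ≡ b × All (λ a′ → π a′ ∉ b ∷ bs) as
separating-injection {b = b} {as} {bs} a∷as! fits
  with ys , |ys|≡ , ys! , ys∉ ← fresh-colours (b ∷ bs) (length as) fits
  with π , π-inj , πa∷as≡b∷ys ←
         matching-injection a∷as! (All.map (λ y∉ b≡y → y∉ (here (sym b≡y))) ys∉ ∷ ys!) (cong suc (sym |ys|≡))
  with πa≡b , πas≡ys ← ∷-injective πa∷as≡b∷ys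
  = π , π-inj , πa≡b , All.map⁻ (subst (All (_∉ b ∷ bs)) (sym πas≡ys) ys∉)

Adj-sym : ∀ {n} (G : Graph n) {x y} → Adj G x y → Adj G y x
Adj-sym G {x} {y} = trans (Graph.sym G y x)

deleteEdge-Adj : ∀ {n} (G : Graph n) a b {x y} → Adj G x y → x ≢ a → y ≢ a → Adj (deleteEdge G a b) x y
deleteEdge-Adj G a b {x} {y} x~y x≢a y≢a
  rewrite x~y | dec-false (x ≟ a) x≢a | dec-false (y ≟ a) y≢a = refl

neighbours : ∀ {n} → Graph n → Fin n → List (Fin n)
neighbours {n} G v = filter (λ u → adj G v u Bool.≟ true) (allFin n)

neighbours-unique : ∀ {n} (G : Graph n) v → Unique (neighbours G v)
neighbours-unique {n} G v = filter⁺ _ (allFin⁺ n)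

∈-neighbours⁺ : ∀ {n} (G : Graph n) {v x} → Adj G v x → x ∈ neighbours G v
∈-neighbours⁺ G v~x = ∈-filter⁺ _ (∈-allFin _) v~x

∈-neighbours⁻ : ∀ {n} (G : Graph n) {v x} → x ∈ neighbours G v → Adj G v x
∈-neighbours⁻ {n} G x∈ = proj₂ (∈-filter⁻ _ {xs = allFin n} x∈)

degree≤maxDegree : ∀ {n} (G : Graph n) v → degree G v ≤ maxDegree G
degree≤maxDegree G v = ≤-foldr-⊔ (degree G) (∈-allFin v)

walk-end : ∀ {n} {G : Graph n} {P a b} → WalkAvoiding G P a b → ¬ P b
walk-end (here ¬Pa)     = ¬Pa
walk-end (step _ _ walk) = walk-end walk

walk-snoc : ∀ {n} {G : Graph n} {P a b c} → WalkAvoiding G P a b → Adj G b c → ¬ P c → WalkAvoiding G P a c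
walk-snoc (here ¬Pa)         b~c ¬Pc = step ¬Pa b~c (here ¬Pc)
walk-snoc (step ¬Pa a~x walk) b~c ¬Pc = step ¬Pa a~x (walk-snoc walk b~c ¬Pc)

walk-neighbour : ∀ {n} {G : Graph n} {P a b} → WalkAvoiding G P a b → a ≢ b → ∃ (Adj G a)
walk-neighbour (here _)       a≢a = contradiction refl a≢a
walk-neighbour (step _ a~x _) _   = _ , a~x

recolour : ∀ {n} {G : Graph n} {k l} → TotalColouring G k → (π : Fin k → Fin l) → Injective _≡_ _≡_ π →
  TotalColouring G l
recolour c π π-inj = record
  { vcol = π ∘ vcol
  ; ecol = λ x y → π (ecol x y)
  ; ecol-sym = λ x y x~y → cong π (ecol-sym x y x~y)
  ; vv = λ x y x~y → vv x y x~y ∘ π-inj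
  ; ee = λ x y z x~y x~z y≢z → ee x y z x~y x~z y≢z ∘ π-inj
  ; ve = λ x y x~y → ve x y x~y ∘ π-inj
  }
  where open TotalColouring c

module _ {n} {G : Graph n} {k} (c : TotalColouring G k) where
  open TotalColouring c

  edge-colours-unique : ∀ {v zs} → Unique zs → All (Adj G v) zs → Unique (map (ecol v) zs)
  edge-colours-unique []            []          = []
  edge-colours-unique (z∉zs ∷ zs!) (v~z ∷ v~zs) =
    All.map⁺ (All.zipWith (λ (z≢y , v~y) → ee _ _ _ v~z v~y z≢y) (z∉zs , v~zs))
    ∷ edge-colours-unique zs! v~zs

  colours-at-unique : ∀ {v zs} → Unique zs → All (Adj G v) zs → Unique (vcol v ∷ map (ecol v) zs)
  colours-at-unique zs! v~zs = All.map⁺ (All.map (ve _ _) v~zs) ∷ edge-colours-unique zs! v~zs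

module _ {n} {H : Graph n} {v : Fin n} {S : Pred (Fin n) 0ℓ} (S? : Decidable S)
         (S-closed : ∀ {x y} → S x → Adj H x y → y ≢ v → S y)
         {G₁ G₂ : Graph n} {k}
         (⊆G₁ : ∀ {x y} → S x → Adj H x y → Adj G₁ x y)
         (⊆G₂ : ∀ {x y} → ¬ S x → ¬ S y → Adj H x y → Adj G₂ x y)
         (c₁ : TotalColouring G₁ k) (c₂ : TotalColouring G₂ k)
         (vcol-agree : TotalColouring.vcol c₂ v ≡ TotalColouring.vcol c₁ v)
         (ecol-apart : ∀ {y z} → Adj H v y → S y → Adj H v z → ¬ S z →
                       TotalColouring.ecol c₂ v z ≢ TotalColouring.ecol c₁ v y)
  where
  private
    module C₁ = TotalColouring c₁
    module C₂ = TotalColouring c₂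

    leaves-through-v : ∀ {x y} → S x → Adj H x y → ¬ S y → y ≡ v
    leaves-through-v {y = y} Sx x~y ¬Sy with y ≟ v
    ... | yes y≡v = y≡v
    ... | no  y≢v = contradiction (S-closed Sx x~y y≢v) ¬Sy

    ⊆G₁′ : ∀ {x y} → S y → Adj H x y → Adj G₁ x y
    ⊆G₁′ Sy x~y = Adj-sym G₁ (⊆G₁ Sy (Adj-sym H x~y))

    vcol-agree-at : ∀ {x} → x ≡ v → C₂.vcol x ≡ C₁.vcol x
    vcol-agree-at refl = vcol-agree

    ecol-apart-at : ∀ {x y z} → x ≡ v → Adj H x y → S y → Adj H x z → ¬ S z → C₂.ecol x z ≢ C₁.ecol x y
    ecol-apart-at refl = ecol-apart

    vc : Fin n → Fin k
    vc x with S? x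
    ... | yes _ = C₁.vcol x
    ... | no  _ = C₂.vcol x

    ec : Fin n → Fin n → Fin k
    ec x y with S? x | S? y
    ... | yes _ | _     = C₁.ecol x y
    ... | no  _ | yes _ = C₁.ecol x y
    ... | no  _ | no  _ = C₂.ecol x y

    ec-sym : ∀ x y → Adj H x y → ec x y ≡ ec y x
    ec-sym x y x~y with S? x | S? y
    ... | yes Sx | yes _  = C₁.ecol-sym x y (⊆G₁ Sx x~y)
    ... | yes Sx | no _   = C₁.ecol-sym x y (⊆G₁ Sx x~y)
    ... | no _   | yes Sy = C₁.ecol-sym x y (⊆G₁′ Sy x~y)
    ... | no ¬Sx | no ¬Sy = C₂.ecol-sym x y (⊆G₂ ¬Sx ¬Sy x~y)

    vv : ∀ x y → Adj H x y → vc x ≢ vc y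
    vv x y x~y with S? x | S? y
    ... | yes Sx | yes _  = C₁.vv x y (⊆G₁ Sx x~y)
    ... | yes Sx | no ¬Sy =
      λ eq → C₁.vv x y (⊆G₁ Sx x~y) (trans eq (vcol-agree-at (leaves-through-v Sx x~y ¬Sy)))
    ... | no ¬Sx | yes Sy =
      C₁.vv x y (⊆G₁′ Sy x~y) ∘ trans (sym (vcol-agree-at (leaves-through-v Sy (Adj-sym H x~y) ¬Sx)))
    ... | no ¬Sx | no ¬Sy = C₂.vv x y (⊆G₂ ¬Sx ¬Sy x~y)

    ve : ∀ x y → Adj H x y → vc x ≢ ec x y
    ve x y x~y with S? x | S? y
    ... | yes Sx | _      = C₁.ve x y (⊆G₁ Sx x~y)
    ... | no ¬Sx | yes Sy =
      C₁.ve x y (⊆G₁′ Sy x~y) ∘ trans (sym (vcol-agree-at (leaves-through-v Sy (Adj-sym H x~y) ¬Sx)))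
    ... | no ¬Sx | no ¬Sy = C₂.ve x y (⊆G₂ ¬Sx ¬Sy x~y)

    ee : ∀ x y z → Adj H x y → Adj H x z → y ≢ z → ec x y ≢ ec x z
    ee x y z x~y x~z y≢z with S? x | S? y | S? z
    ... | yes Sx | _      | _      = C₁.ee x y z (⊆G₁ Sx x~y) (⊆G₁ Sx x~z) y≢z
    ... | no _   | yes Sy | yes Sz = C₁.ee x y z (⊆G₁′ Sy x~y) (⊆G₁′ Sz x~z) y≢z
    ... | no ¬Sx | yes Sy | no ¬Sz =
      ecol-apart-at (leaves-through-v Sy (Adj-sym H x~y) ¬Sx) x~y Sy x~z ¬Sz ∘ sym
    ... | no ¬Sx | no ¬Sy | yes Sz =
      ecol-apart-at (leaves-through-v Sz (Adj-sym H x~z) ¬Sx) x~z Sz x~y ¬Sy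
    ... | no ¬Sx | no ¬Sy | no ¬Sz = C₂.ee x y z (⊆G₂ ¬Sx ¬Sy x~y) (⊆G₂ ¬Sx ¬Sz x~z) y≢z

  glue : TotalColouring H k
  glue = record { vcol = vc ; ecol = ec ; ecol-sym = ec-sym ; vv = vv ; ee = ee ; ve = ve }

module _ {n} {H : Graph n} {v : Fin n} {S : Pred (Fin n) 0ℓ} (S? : Decidable S)
         (S-closed : ∀ {x y} → S x → Adj H x y → y ≢ v → S y) (v∉S : ¬ S v)
         {a a′ b b′ : Fin n} (a∉S : ¬ S a) (a≢v : a ≢ v) (b∈S : S b) {k}
         (c₁ : TotalColouring (deleteEdge H a a′) k) (c₂ : TotalColouring (deleteEdge H b b′) k)
         (degree<k : degree H v < k)
  where
  private
    module C₁ = TotalColouring c₁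
    module C₂ = TotalColouring c₂

    ⊆G₁ : ∀ {x y} → S x → Adj H x y → Adj (deleteEdge H a a′) x y
    ⊆G₁ Sx x~y = deleteEdge-Adj H a a′ x~y (λ { refl → a∉S Sx }) (λ { refl → a∉S (S-closed Sx x~y a≢v) })

    ⊆G₂ : ∀ {x y} → ¬ S x → ¬ S y → Adj H x y → Adj (deleteEdge H b b′) x y
    ⊆G₂ ¬Sx ¬Sy x~y = deleteEdge-Adj H b b′ x~y (λ { refl → ¬Sx b∈S }) (λ { refl → ¬Sy b∈S })

    inside outside : List (Fin n)
    inside  = filter S? (neighbours H v)
    outside = filter (∁? S?) (neighbours H v)

    ∈-inside⁺ : ∀ {y} → Adj H v y → S y → C₁.ecol v y ∈ map (C₁.ecol v) inside
    ∈-inside⁺ v~y Sy = ∈-map⁺ (C₁.ecol v) (∈-filter⁺ S? (∈-neighbours⁺ H v~y) Sy)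

    outside-unique : Unique (C₂.vcol v ∷ map (C₂.ecol v) outside)
    outside-unique = colours-at-unique c₂ (filter⁺ (∁? S?) (neighbours-unique H v)) (All.tabulate v~z)
      where
      v~z : ∀ {z} → z ∈ outside → Adj (deleteEdge H b b′) v z
      v~z z∈ with z∈neighbours , ¬Sz ← ∈-filter⁻ (∁? S?) {xs = neighbours H v} z∈
        = ⊆G₂ v∉S ¬Sz (∈-neighbours⁻ H z∈neighbours)

    palette-fits : length (C₁.vcol v ∷ map (C₁.ecol v) inside) + length (map (C₂.ecol v) outside) ≤ k
    palette-fits = ≤-trans (≤-reflexive (cong suc |inside|+|outside|≡degree)) degree<k
      where
      |inside|+|outside|≡degree : length (map (C₁.ecol v) inside) + length (map (C₂.ecol v) outside) ≡ degree H v
      |inside|+|outside|≡degree =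
        trans (cong₂ _+_ (length-map _ inside) (length-map _ outside))
              (length-filter+length-filter-∁ S? (neighbours H v))

  colour-across-cut : TotalColouring H k
  colour-across-cut
    with π , π-inj , πv≡ , π-avoids ← separating-injection outside-unique palette-fits
    = glue S? S-closed ⊆G₁ ⊆G₂ c₁ (recolour c₂ π π-inj) πv≡ apart
    where
    apart : ∀ {y z} → Adj H v y → S y → Adj H v z → ¬ S z → π (C₂.ecol v z) ≢ C₁.ecol v y
    apart v~y Sy v~z ¬Sz eq =
      All.lookup π-avoids (∈-map⁺ (C₂.ecol v) (∈-filter⁺ (∁? S?) (∈-neighbours⁺ H v~z) ¬Sz))
        (there (subst (_∈ _) (sym eq) (∈-inside⁺ v~y Sy)))

lemma1 : ∀ (n : ℕ) (H : Graph n) (t : ℕ) → Connected H → TotalCritical H t →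
    t ≥ maxDegree H + 2 → ∀ (v : Fin n) → ¬ CutVertex H v
lemma1 n H t connected ((_ , no-fewer) , critical) Δ+2≤t v (u , w , u≢v , w≢v , u↛w) =
  ¬¬-decidable S λ S? →
    no-fewer (pred t) pred[t]<t
      (colour-across-cut S? walk-snoc (λ Sv → walk-end Sv refl) u↛w w≢v (here u≢v)
        (critical w w′ w~w′) (critical u u′ u~u′) degree<pred[t])
  where
  S : Fin n → Set
  S = WalkAvoiding H (_≡ v) u

  u′ w′ : Fin n
  u′ = proj₁ (walk-neighbour (connected u v) u≢v)
  w′ = proj₁ (walk-neighbour (connected w v) w≢v)

  u~u′ : Adj H u u′
  u~u′ = proj₂ (walk-neighbour (connected u v) u≢v)

  w~w′ : Adj H w w′
  w~w′ = proj₂ (walk-neighbour (connected w v) w≢v)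

  degree+2≤t : suc (suc (degree H v)) ≤ t
  degree+2≤t = ≤-trans (≤-reflexive (+-comm 2 _)) (≤-trans (+-monoˡ-≤ 2 (degree≤maxDegree H v)) Δ+2≤t)

  degree<pred[t] : degree H v < pred t
  degree<pred[t] = proj₁ (2+m≤n⇒m<pred[n]<n degree+2≤t)

  pred[t]<t : pred t < t
  pred[t]<t = proj₂ (2+m≤n⇒m<pred[n]<n degree+2≤t)
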